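{- Let $m\ge1$ and let $G^c=(V,E)$ be the cocktail party graph on $2m$ vertices (obtained from $K_{2m}$ by deleting the edges of a perfect matching), with its edges colored by two colors $1,2$. Let $e=\{x,y\}$ be a pair of vertices that is critical for color 1 and $f=\{p,q\}$ a pair of vertices that is critical for color 2. If $e\cap f\neq\emptyset$, then $V$ can be covered by two monochromatic stars, or by the vertex sets of two monochromatic subgraphs each of which belongs to $\mathcal{C}_5^+$. That is, either there exist vertices $u,w$ and colors $i,j$ with $S_i(u)\cup S_j(w)=V$, or there exist colors $i,j$ and subgraphs $H\subseteq G^c_i$, $H'\subseteq G^c_j$ with $H,H'\in\mathcal{C}_5^+$ and $V(H)\cup V(H')=V$.
   Context: $G^c_i$ is the spanning subgraph of $G^c$ formed by the edges of color $i$. A pair of distinct vertices $x,y$ (not necessarily adjacent) is critical for color $i$ if the distance between $x$ and $y$ in $G^c_i$ is greater than two (possibly infinite). For a vertex $v$, $N_i(v)$ is the set of vertices joined to $v$ by an edge of color $i$, and the monochromatic star $S_i(v)$ is the star with center $v$ and edges of color $i$; its vertex set is $\{v\}\cup N_i(v)$, and "covered by stars" refers to these vertex sets. $\mathcal{C}_5^+$ is the family of graphs obtained from a five-cycle $v_1v_2v_3v_4v_5$ by replacing each vertex $v_k$ with a nonempty independent set $V_k$ and each cycle edge $v_kv_{k+1}$ (indices mod 5) by the complete bipartite graph between $V_k$ and $V_{k+1}$; every graph in $\mathcal{C}_5^+$ has diameter two. -}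

module Defs where

open import Data.Nat using (ℕ)
open import Data.Fin using (Fin; zero; suc)
open import Data.Bool using (Bool)
open import Data.Product using (_×_; Σ; ∃; _,_)
open import Data.Sum using (_⊎_)
open import Data.Maybe using (Maybe; just; nothing)
open import Relation.Nullary using (¬_)
open import Relation.Binary.PropositionalEquality using (_≡_; _≢_)

-- Vertex set of the cocktail party graph on 2m vertices: pairs (a , b),
-- the perfect matching removed from K_{2m} is {(a,false),(a,true)}.
Vertex : ℕ → Set
Vertex m = Fin m × Bool

first : ∀ {m} → Vertex m → Fin m
first (a , _) = a

Adj : ∀ {m} → Vertex m → Vertex m → Set
Adj x y = first x ≢ first y

Color : Set
Color = Fin 2

-- a 2-edge-coloring: a color for each ordered pair, symmetric on edges
-- (values on non-edges are irrelevant)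
record Coloring (m : ℕ) : Set where
  field
    col  : Vertex m → Vertex m → Color
    symm : ∀ x y → Adj x y → col x y ≡ col y x
open Coloring public

Edge : ∀ {m} → Coloring m → Color → Vertex m → Vertex m → Set
Edge c i x y = Adj x y × col c x y ≡ i

DistLe2 : ∀ {m} → Coloring m → Color → Vertex m → Vertex m → Set
DistLe2 c i x y = x ≡ y ⊎ Edge c i x y ⊎ ∃ λ z → Edge c i x z × Edge c i z y

Critical : ∀ {m} → Coloring m → Color → Vertex m → Vertex m → Set
Critical c i x y = x ≢ y × ¬ DistLe2 c i x y

InStar : ∀ {m} → Coloring m → Color → Vertex m → Vertex m → Set
InStar c i u v = v ≡ u ⊎ Edge c i u v

next5 : Fin 5 → Fin 5
next5 zero = suc zero
next5 (suc zero) = suc (suc zero)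
next5 (suc (suc zero)) = suc (suc (suc zero))
next5 (suc (suc (suc zero))) = suc (suc (suc (suc zero)))
next5 (suc (suc (suc (suc zero)))) = zero

-- A subgraph H of G^c_i belonging to C5+ : given by a labelling
-- part : V → Maybe (Fin 5); V(H) = vertices with a label, V_k = label k
-- (each nonempty), and E(H) = all pairs between V_k and V_{k+1 mod 5},
-- all of which must be edges of colour i (so H ⊆ G^c_i).
record C5Sub {m} (c : Coloring m) (i : Color) : Set where
  field
    part     : Vertex m → Maybe (Fin 5)
    nonempty : ∀ k → ∃ λ v → part v ≡ just k
    edges    : ∀ x y k → part x ≡ just k → part y ≡ just (next5 k) → Edge c i x y
open C5Sub public

InSub : ∀ {m} {c : Coloring m} {i : Color} → C5Sub c i → Vertex m → Set
InSub H v = ∃ λ k → part H v ≡ just k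

{-# OPTIONS --safe #-}
module Submission where

-- Colours 0F and 1F are the paper's colours 1 and 2. Let the critical pairs be {x,y} for 0F
-- and {x,q} for 1F. If one of them is a pair of twins (non-adjacent in the cocktail party
-- graph), every other vertex v is adjacent to both, and the two edges from v cannot both have
-- the critical colour; so the two stars of the other colour centred at the pair cover V.
-- Otherwise xy has colour 1F and xq colour 0F, which forces y and q to be twins; let t be the
-- twin of x. Every remaining vertex v is adjacent to x, t, y and q, and criticality gives
-- col y v = 1F when col x v = 0F, and col q v = 0F when col x v = 1F. Hence S_1F(y) ∪ S_0F(q)
-- covers V unless col t y = 0F and col t q = 1F. In that case sort the remaining vertices by
-- their profile (col x v , col t v): if one of the four profile classes is empty, two stars
-- centred at t and at one of x, y, q cover V; if none is, the sequences x, q, [1F 0F], t, [0F 0F]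
-- and x, y, [0F 1F], t, [1F 1F] are blown-up five-cycles of colours 0F and 1F covering V.

open import Defs
open import Data.Nat using (ℕ; _≤_)
open import Data.Fin using (Fin; zero; suc)
open import Data.Fin.Patterns using (0F; 1F; 2F; 3F; 4F)
import Data.Fin.Properties as Fin
open import Data.Bool using (false; true; not)
import Data.Bool.Properties as Bool
open import Data.Maybe using (Maybe; just; nothing)
open import Data.Product using (_×_; Σ; ∃; _,_; proj₂)
open import Data.Product.Properties using (≡-dec)
open import Data.Sum using (_⊎_; inj₁; inj₂; [_,_])
import Data.Sum as Sum
open import Data.Empty using (⊥-elim)
open import Function using (_∘_; id)
open import Relation.Nullary using (¬_; Dec; yes; no; ¬?)
open import Relation.Nullary.Decidable using (map′; _×-dec_; _⊎-dec_)
open import Relation.Binary.PropositionalEquality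
  using (_≡_; _≢_; refl; sym; trans; cong; cong₂; subst)

other : Color → Color
other 0F = 1F
other 1F = 0F

≡-or-other : ∀ i j → j ≡ i ⊎ j ≡ other i
≡-or-other 0F 0F = inj₁ refl
≡-or-other 0F 1F = inj₂ refl
≡-or-other 1F 0F = inj₂ refl
≡-or-other 1F 1F = inj₁ refl

module _ {m : ℕ} where

  _≟v_ : (u v : Vertex m) → Dec (u ≡ v)
  _≟v_ = ≡-dec Fin._≟_ Bool._≟_

  ∃-vertex? : {P : Vertex m → Set} → (∀ v → Dec (P v)) → Dec (∃ P)
  ∃-vertex? P? = map′
    (λ { (a , inj₁ p) → (a , false) , p ; (a , inj₂ p) → (a , true) , p })
    (λ { ((a , false) , p) → a , inj₁ p ; ((a , true) , p) → a , inj₂ p })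
    (Fin.any? λ a → P? (a , false) ⊎-dec P? (a , true))

  twin : Vertex m → Vertex m
  twin v = first v , not (proj₂ v)

  twin-cases : {u v : Vertex m} → first u ≡ first v → v ≡ u ⊎ v ≡ twin u
  twin-cases {a , b} {.a , b′} refl with b′ Bool.≟ b
  ... | yes refl = inj₁ refl
  ... | no b′≢b  = inj₂ (cong (a ,_) (Bool.¬-not b′≢b))

  twin-unique : {u v : Vertex m} → first u ≡ first v → u ≢ v → v ≡ twin u
  twin-unique u≈v u≢v = [ ⊥-elim ∘ u≢v ∘ sym , id ] (twin-cases u≈v)

  twin-≢ : (u : Vertex m) → u ≢ twin u
  twin-≢ u = Bool.not-¬ refl ∘ cong proj₂

  ≢-twins⇒Adj : {u v : Vertex m} → v ≢ u → v ≢ twin u → Adj u v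
  ≢-twins⇒Adj v≢u v≢u′ = [ v≢u , v≢u′ ] ∘ twin-cases

  Adj⇒≢ : {u v : Vertex m} → Adj u v → u ≢ v
  Adj⇒≢ u~v = u~v ∘ cong first

  StarCover : Coloring m → Set
  StarCover c = ∃ λ u → ∃ λ w → ∃ λ i → ∃ λ j → ∀ v → InStar c i u v ⊎ InStar c j w v

  C5Cover : Coloring m → Set
  C5Cover c = ∃ λ i → ∃ λ j → Σ (C5Sub c i) λ H → Σ (C5Sub c j) λ H′ → ∀ v → InSub H v ⊎ InSub H′ v

record Cycle5 (K : Set) : Set where
  field
    block       : Fin 5 → K
    index       : K → Maybe (Fin 5)
    index-block : ∀ k → index (block k) ≡ just k
    index⇒block : ∀ κ {k} → index κ ≡ just k → block k ≡ κ
open Cycle5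

module _ {m : ℕ} (c : Coloring m) where

  edge-sym : ∀ {i} {u v : Vertex m} → Edge c i u v → Edge c i v u
  edge-sym {u = u} {v} (u~v , col≡i) = u~v ∘ sym , trans (sym (symm c u v u~v)) col≡i

  critical-sym : ∀ {i} {x y : Vertex m} → Critical c i x y → Critical c i y x
  critical-sym (x≢y , far) = x≢y ∘ sym , far ∘ flip
    where
    flip : ∀ {i x y} → DistLe2 c i y x → DistLe2 c i x y
    flip (inj₁ y≡x)                  = inj₁ (sym y≡x)
    flip (inj₂ (inj₁ yx))            = inj₂ (inj₁ (edge-sym yx))
    flip (inj₂ (inj₂ (z , yz , zx))) = inj₂ (inj₂ (z , edge-sym zx , edge-sym yz))

  critical-edge-colour : ∀ {i} {x y : Vertex m} → Critical c i x y → Adj x y → col c x y ≡ other i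
  critical-edge-colour {i} {x} {y} (_ , far) x~y with ≡-or-other i (col c x y)
  ... | inj₁ xy≡i = ⊥-elim (far (inj₂ (inj₁ (x~y , xy≡i))))
  ... | inj₂ xy≡i′ = xy≡i′

  critical-neighbour-colour : ∀ {i} {x y v : Vertex m} → Critical c i x y
                            → Edge c i x v → Adj y v → col c y v ≡ other i
  critical-neighbour-colour {i} {y = y} {v} (_ , far) xv y~v with ≡-or-other i (col c y v)
  ... | inj₁ yv≡i = ⊥-elim (far (inj₂ (inj₂ (v , xv , edge-sym (y~v , yv≡i)))))
  ... | inj₂ yv≡i′ = yv≡i′

  critical-twins⇒cover : ∀ {i} {x y : Vertex m} → Critical c i x y → first x ≡ first y
                       → ∀ v → InStar c (other i) x v ⊎ InStar c (other i) y v
  critical-twins⇒cover {i} {x} {y} cr@(x≢y , _) x≈y v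
    with first x Fin.≟ first v | ≡-or-other i (col c x v)
  ... | yes x≈v | _ with twin-cases {u = x} {v} x≈v
  ...   | inj₁ refl = inj₁ (inj₁ refl)
  ...   | inj₂ refl = inj₂ (inj₁ (sym (twin-unique x≈y x≢y)))
  critical-twins⇒cover {i} {x} {y} cr x≈y v | no x~v | inj₂ xv≡i′ = inj₁ (inj₂ (x~v , xv≡i′))
  critical-twins⇒cover {i} {x} {y} cr x≈y v | no x~v | inj₁ xv≡i  =
    inj₂ (inj₂ (y~v , critical-neighbour-colour cr (x~v , xv≡i) y~v))
    where
    y~v : Adj y v
    y~v y≈v = x~v (trans x≈y y≈v)

  C5-blow-up : ∀ {i} {K : Set} (C : Cycle5 K) (kind : Vertex m → K)
             → (∀ k → ∃ λ v → kind v ≡ block C k)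
             → (∀ k {u w} → kind u ≡ block C k → kind w ≡ block C (next5 k) → Edge c i u w)
             → C5Sub c i
  part (C5-blow-up C kind _ _) = index C ∘ kind
  nonempty (C5-blow-up C kind inhabited _) k with inhabited k
  ... | v , kind≡ = v , trans (cong (index C) kind≡) (index-block C k)
  edges (C5-blow-up C kind _ consecutive) u w k u∈k w∈k+1 =
    consecutive k (sym (index⇒block C _ u∈k)) (sym (index⇒block C _ w∈k+1))

  module SharedEndpoint {x y q : Vertex m} (crit₀ : Critical c 0F x y) (crit₁ : Critical c 1F x q)
                        (x~y : Adj x y) (x~q : Adj x q) where

    xy : Edge c 1F x y
    xy = x~y , critical-edge-colour crit₀ x~y

    xq : Edge c 0F x q
    xq = x~q , critical-edge-colour crit₁ x~q

    y≈q : first y ≡ first q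
    y≈q with first y Fin.≟ first q
    ... | yes y≈q = y≈q
    ... | no y~q with trans (sym (critical-neighbour-colour crit₀ xq y~q))
                            (trans (symm c y q y~q) (critical-neighbour-colour crit₁ xy (y~q ∘ sym)))
    ...   | ()

    y≢q : y ≢ q
    y≢q refl with trans (sym (proj₂ xy)) (proj₂ xq)
    ... | ()

    t : Vertex m
    t = twin x

    Other : Vertex m → Set
    Other v = Adj x v × Adj y v

    q~ : ∀ {v} → Other v → Adj q v
    q~ (_ , y~v) q≈v = y~v (trans y≈q q≈v)

    x-edge : ∀ {a v} → Other v → col c x v ≡ a → Edge c a x v
    x-edge (x~v , _) xv≡a = x~v , xv≡a

    t-edge : ∀ {b v} → Other v → col c t v ≡ b → Edge c b t v
    t-edge (x~v , _) tv≡b = x~v , tv≡b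

    y-edge : ∀ {v} → Other v → col c x v ≡ 0F → Edge c 1F y v
    y-edge o@(_ , y~v) xv≡0 = y~v , critical-neighbour-colour crit₀ (x-edge o xv≡0) y~v

    q-edge : ∀ {v} → Other v → col c x v ≡ 1F → Edge c 0F q v
    q-edge {v} o xv≡1 = q~ {v} o , critical-neighbour-colour crit₁ (x-edge o xv≡1) (q~ {v} o)

    data Kind : Set where
      is-x is-t is-y is-q : Kind
      profile : Color → Color → Kind

    Kinded : Kind → Vertex m → Set
    Kinded is-x          v = v ≡ x
    Kinded is-t          v = v ≡ t
    Kinded is-y          v = v ≡ y
    Kinded is-q          v = v ≡ q
    Kinded (profile a b) v = Other v × col c x v ≡ a × col c t v ≡ b

    kind : Vertex m → Kind
    kind v with v ≟v x | v ≟v t | v ≟v y | v ≟v q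
    ... | yes _ | _     | _     | _     = is-x
    ... | no _  | yes _ | _     | _     = is-t
    ... | no _  | no _  | yes _ | _     = is-y
    ... | no _  | no _  | no _  | yes _ = is-q
    ... | no _  | no _  | no _  | no _  = profile (col c x v) (col c t v)

    kind-spec : ∀ v → Kinded (kind v) v
    kind-spec v with v ≟v x | v ≟v t | v ≟v y | v ≟v q
    ... | yes v≡x | _       | _       | _       = v≡x
    ... | no _    | yes v≡t | _       | _       = v≡t
    ... | no _    | no _    | yes v≡y | _       = v≡y
    ... | no _    | no _    | no _    | yes v≡q = v≡q
    ... | no v≢x  | no v≢t  | no v≢y  | no v≢q  =
      (≢-twins⇒Adj v≢x v≢t , ≢-twins⇒Adj v≢y (subst (v ≢_) (twin-unique y≈q y≢q) v≢q)) , refl , refl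

    kinded : ∀ {κ v} → kind v ≡ κ → Kinded κ v
    kinded {v = v} kind≡κ = subst (λ κ → Kinded κ v) kind≡κ (kind-spec v)

    Kinded⇒kind : ∀ κ {v} → Kinded κ v → kind v ≡ κ
    Kinded⇒kind is-x refl with x ≟v x
    ... | yes _   = refl
    ... | no x≢x  = ⊥-elim (x≢x refl)
    Kinded⇒kind is-t refl with t ≟v x | t ≟v t
    ... | yes t≡x | _      = ⊥-elim (twin-≢ x (sym t≡x))
    ... | no _    | yes _  = refl
    ... | no _    | no t≢t = ⊥-elim (t≢t refl)
    Kinded⇒kind is-y refl with y ≟v x | y ≟v t | y ≟v y
    ... | yes y≡x | _       | _      = ⊥-elim (Adj⇒≢ x~y (sym y≡x))
    ... | no _    | yes y≡t | _      = ⊥-elim (Adj⇒≢ {u = t} x~y (sym y≡t))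
    ... | no _    | no _    | yes _  = refl
    ... | no _    | no _    | no y≢y = ⊥-elim (y≢y refl)
    Kinded⇒kind is-q refl with q ≟v x | q ≟v t | q ≟v y | q ≟v q
    ... | yes q≡x | _       | _       | _      = ⊥-elim (Adj⇒≢ x~q (sym q≡x))
    ... | no _    | yes q≡t | _       | _      = ⊥-elim (Adj⇒≢ {u = t} x~q (sym q≡t))
    ... | no _    | no _    | yes q≡y | _      = ⊥-elim (y≢q (sym q≡y))
    ... | no _    | no _    | no _    | yes _  = refl
    ... | no _    | no _    | no _    | no q≢q = ⊥-elim (q≢q refl)
    Kinded⇒kind (profile a b) {v} (o@(x~v , y~v) , xv≡a , tv≡b) with v ≟v x | v ≟v t | v ≟v y | v ≟v q
    ... | yes v≡x | _       | _       | _       = ⊥-elim (Adj⇒≢ x~v (sym v≡x))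
    ... | no _    | yes v≡t | _       | _       = ⊥-elim (Adj⇒≢ {u = t} x~v (sym v≡t))
    ... | no _    | no _    | yes v≡y | _       = ⊥-elim (Adj⇒≢ y~v (sym v≡y))
    ... | no _    | no _    | no _    | yes v≡q = ⊥-elim (Adj⇒≢ (q~ {v} o) (sym v≡q))
    ... | no _    | no _    | no _    | no _    = cong₂ profile xv≡a tv≡b

    profile? : ∀ a b v → Dec (Kinded (profile a b) v)
    profile? a b v = (¬? (first x Fin.≟ first v) ×-dec ¬? (first y Fin.≟ first v))
                     ×-dec col c x v Fin.≟ a ×-dec col c t v Fin.≟ b

    cover-y-q : col c t y ≡ 1F ⊎ col c t q ≡ 0F → ∀ v → InStar c 1F y v ⊎ InStar c 0F q v
    cover-y-q ty⊎tq v with kind v | kind-spec v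
    ... | is-x          | refl          = inj₁ (inj₂ (edge-sym xy))
    ... | is-t          | refl          =
      Sum.map (λ ty≡1 → inj₂ (edge-sym (x~y , ty≡1))) (λ tq≡0 → inj₂ (edge-sym (x~q , tq≡0))) ty⊎tq
    ... | is-y          | refl          = inj₁ (inj₁ refl)
    ... | is-q          | refl          = inj₂ (inj₁ refl)
    ... | profile 0F _  | o , xv≡0 , _  = inj₁ (inj₂ (y-edge o xv≡0))
    ... | profile 1F _  | o , xv≡1 , _  = inj₂ (inj₂ (q-edge o xv≡1))

    module _ (ty≡0 : col c t y ≡ 0F) (tq≡1 : col c t q ≡ 1F) where

      ty : Edge c 0F t y
      ty = x~y , ty≡0

      tq : Edge c 1F t q
      tq = x~q , tq≡1

      cover-x-t₀ : ¬ ∃ (Kinded (profile 1F 1F)) → ∀ v → InStar c 0F x v ⊎ InStar c 0F t v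
      cover-x-t₀ none v with kind v | kind-spec v
      ... | is-x          | refl            = inj₁ (inj₁ refl)
      ... | is-t          | refl            = inj₂ (inj₁ refl)
      ... | is-y          | refl            = inj₂ (inj₂ ty)
      ... | is-q          | refl            = inj₁ (inj₂ xq)
      ... | profile 0F _  | o , xv≡0 , _    = inj₁ (inj₂ (x-edge o xv≡0))
      ... | profile 1F 0F | o , _ , tv≡0    = inj₂ (inj₂ (t-edge o tv≡0))
      ... | profile 1F 1F | v∈₁₁            = ⊥-elim (none (v , v∈₁₁))

      cover-x-t₁ : ¬ ∃ (Kinded (profile 0F 0F)) → ∀ v → InStar c 1F x v ⊎ InStar c 1F t v
      cover-x-t₁ none v with kind v | kind-spec v
      ... | is-x          | refl            = inj₁ (inj₁ refl)
      ... | is-t          | refl            = inj₂ (inj₁ refl)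
      ... | is-y          | refl            = inj₁ (inj₂ xy)
      ... | is-q          | refl            = inj₂ (inj₂ tq)
      ... | profile 1F _  | o , xv≡1 , _    = inj₁ (inj₂ (x-edge o xv≡1))
      ... | profile 0F 1F | o , _ , tv≡1    = inj₂ (inj₂ (t-edge o tv≡1))
      ... | profile 0F 0F | v∈₀₀            = ⊥-elim (none (v , v∈₀₀))

      cover-q-t : ¬ ∃ (Kinded (profile 0F 1F)) → ∀ v → InStar c 0F q v ⊎ InStar c 0F t v
      cover-q-t none v with kind v | kind-spec v
      ... | is-x          | refl            = inj₁ (inj₂ (edge-sym xq))
      ... | is-t          | refl            = inj₂ (inj₁ refl)
      ... | is-y          | refl            = inj₂ (inj₂ ty)
      ... | is-q          | refl            = inj₁ (inj₁ refl)
      ... | profile 1F _  | o , xv≡1 , _    = inj₁ (inj₂ (q-edge o xv≡1))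
      ... | profile 0F 0F | o , _ , tv≡0    = inj₂ (inj₂ (t-edge o tv≡0))
      ... | profile 0F 1F | v∈₀₁            = ⊥-elim (none (v , v∈₀₁))

      cover-y-t : ¬ ∃ (Kinded (profile 1F 0F)) → ∀ v → InStar c 1F y v ⊎ InStar c 1F t v
      cover-y-t none v with kind v | kind-spec v
      ... | is-x          | refl            = inj₁ (inj₂ (edge-sym xy))
      ... | is-t          | refl            = inj₂ (inj₁ refl)
      ... | is-y          | refl            = inj₁ (inj₁ refl)
      ... | is-q          | refl            = inj₂ (inj₂ tq)
      ... | profile 0F _  | o , xv≡0 , _    = inj₁ (inj₂ (y-edge o xv≡0))
      ... | profile 1F 1F | o , _ , tv≡1    = inj₂ (inj₂ (t-edge o tv≡1))
      ... | profile 1F 0F | v∈₁₀            = ⊥-elim (none (v , v∈₁₀))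

    cycle₀ : Cycle5 Kind
    block cycle₀ 0F = is-x
    block cycle₀ 1F = is-q
    block cycle₀ 2F = profile 1F 0F
    block cycle₀ 3F = is-t
    block cycle₀ 4F = profile 0F 0F
    index cycle₀ is-x            = just 0F
    index cycle₀ is-q            = just 1F
    index cycle₀ (profile 1F 0F) = just 2F
    index cycle₀ is-t            = just 3F
    index cycle₀ (profile 0F 0F) = just 4F
    index cycle₀ _               = nothing
    index-block cycle₀ 0F = refl
    index-block cycle₀ 1F = refl
    index-block cycle₀ 2F = refl
    index-block cycle₀ 3F = refl
    index-block cycle₀ 4F = refl
    index⇒block cycle₀ is-x            refl = refl
    index⇒block cycle₀ is-q            refl = refl
    index⇒block cycle₀ (profile 1F 0F) refl = refl
    index⇒block cycle₀ is-t            refl = refl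
    index⇒block cycle₀ (profile 0F 0F) refl = refl
    index⇒block cycle₀ is-y            ()
    index⇒block cycle₀ (profile 0F 1F) ()
    index⇒block cycle₀ (profile 1F 1F) ()

    cycle₁ : Cycle5 Kind
    block cycle₁ 0F = is-x
    block cycle₁ 1F = is-y
    block cycle₁ 2F = profile 0F 1F
    block cycle₁ 3F = is-t
    block cycle₁ 4F = profile 1F 1F
    index cycle₁ is-x            = just 0F
    index cycle₁ is-y            = just 1F
    index cycle₁ (profile 0F 1F) = just 2F
    index cycle₁ is-t            = just 3F
    index cycle₁ (profile 1F 1F) = just 4F
    index cycle₁ _               = nothing
    index-block cycle₁ 0F = refl
    index-block cycle₁ 1F = refl
    index-block cycle₁ 2F = refl
    index-block cycle₁ 3F = refl
    index-block cycle₁ 4F = refl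
    index⇒block cycle₁ is-x            refl = refl
    index⇒block cycle₁ is-y            refl = refl
    index⇒block cycle₁ (profile 0F 1F) refl = refl
    index⇒block cycle₁ is-t            refl = refl
    index⇒block cycle₁ (profile 1F 1F) refl = refl
    index⇒block cycle₁ is-q            ()
    index⇒block cycle₁ (profile 0F 0F) ()
    index⇒block cycle₁ (profile 1F 0F) ()

    cycle₀-edges : ∀ k {u w} → Kinded (block cycle₀ k) u → Kinded (block cycle₀ (next5 k)) w
                 → Edge c 0F u w
    cycle₀-edges 0F refl             refl             = xq
    cycle₀-edges 1F refl             (o , xw≡1 , _)   = q-edge o xw≡1
    cycle₀-edges 2F (o , _ , tu≡0)   refl             = edge-sym (t-edge o tu≡0)
    cycle₀-edges 3F refl             (o , _ , tw≡0)   = t-edge o tw≡0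
    cycle₀-edges 4F (o , xu≡0 , _)   refl             = edge-sym (x-edge o xu≡0)

    cycle₁-edges : ∀ k {u w} → Kinded (block cycle₁ k) u → Kinded (block cycle₁ (next5 k)) w
                 → Edge c 1F u w
    cycle₁-edges 0F refl             refl             = xy
    cycle₁-edges 1F refl             (o , xw≡0 , _)   = y-edge o xw≡0
    cycle₁-edges 2F (o , _ , tu≡1)   refl             = edge-sym (t-edge o tu≡1)
    cycle₁-edges 3F refl             (o , _ , tw≡1)   = t-edge o tw≡1
    cycle₁-edges 4F (o , xu≡1 , _)   refl             = edge-sym (x-edge o xu≡1)

    cycles-cover : ∀ κ → (∃ λ k → index cycle₀ κ ≡ just k) ⊎ (∃ λ k → index cycle₁ κ ≡ just k)
    cycles-cover is-x            = inj₁ (0F , refl)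
    cycles-cover is-t            = inj₁ (3F , refl)
    cycles-cover is-y            = inj₂ (1F , refl)
    cycles-cover is-q            = inj₁ (1F , refl)
    cycles-cover (profile 0F 0F) = inj₁ (4F , refl)
    cycles-cover (profile 1F 0F) = inj₁ (2F , refl)
    cycles-cover (profile 0F 1F) = inj₂ (2F , refl)
    cycles-cover (profile 1F 1F) = inj₂ (4F , refl)

    two-C5-cover : ∃ (Kinded (profile 1F 0F)) → ∃ (Kinded (profile 0F 0F))
                 → ∃ (Kinded (profile 0F 1F)) → ∃ (Kinded (profile 1F 1F)) → C5Cover c
    two-C5-cover (v₁₀ , v₁₀∈) (v₀₀ , v₀₀∈) (v₀₁ , v₀₁∈) (v₁₁ , v₁₁∈) =
      0F , 1F , H₀ , H₁ , cycles-cover ∘ kind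
      where
      H₀ : C5Sub c 0F
      H₀ = C5-blow-up cycle₀ kind
        (λ { 0F → x , Kinded⇒kind is-x refl ; 1F → q , Kinded⇒kind is-q refl
           ; 2F → v₁₀ , Kinded⇒kind _ v₁₀∈ ; 3F → t , Kinded⇒kind is-t refl
           ; 4F → v₀₀ , Kinded⇒kind _ v₀₀∈ })
        (λ k u∈k w∈k+1 → cycle₀-edges k (kinded u∈k) (kinded w∈k+1))
      H₁ : C5Sub c 1F
      H₁ = C5-blow-up cycle₁ kind
        (λ { 0F → x , Kinded⇒kind is-x refl ; 1F → y , Kinded⇒kind is-y refl
           ; 2F → v₀₁ , Kinded⇒kind _ v₀₁∈ ; 3F → t , Kinded⇒kind is-t refl
           ; 4F → v₁₁ , Kinded⇒kind _ v₁₁∈ })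
        (λ k u∈k w∈k+1 → cycle₁-edges k (kinded u∈k) (kinded w∈k+1))

    cover : StarCover c ⊎ C5Cover c
    cover with ≡-or-other 0F (col c t y) | ≡-or-other 1F (col c t q)
    ... | inj₂ ty≡1 | _         = inj₁ (y , q , 1F , 0F , cover-y-q (inj₁ ty≡1))
    ... | inj₁ _    | inj₂ tq≡0 = inj₁ (y , q , 1F , 0F , cover-y-q (inj₂ tq≡0))
    ... | inj₁ ty≡0 | inj₁ tq≡1
      with ∃-vertex? (profile? 1F 1F) | ∃-vertex? (profile? 0F 0F)
         | ∃-vertex? (profile? 0F 1F) | ∃-vertex? (profile? 1F 0F)
    ...   | no ∄₁₁  | _        | _        | _        = inj₁ (x , t , 0F , 0F , cover-x-t₀ ty≡0 tq≡1 ∄₁₁)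
    ...   | _       | no ∄₀₀   | _        | _        = inj₁ (x , t , 1F , 1F , cover-x-t₁ ty≡0 tq≡1 ∄₀₀)
    ...   | _       | _        | no ∄₀₁   | _        = inj₁ (q , t , 0F , 0F , cover-q-t ty≡0 tq≡1 ∄₀₁)
    ...   | _       | _        | _        | no ∄₁₀   = inj₁ (y , t , 1F , 1F , cover-y-t ty≡0 tq≡1 ∄₁₀)
    ...   | yes v₁₁ | yes v₀₀  | yes v₀₁  | yes v₁₀  = inj₂ (two-C5-cover v₁₀ v₀₀ v₀₁ v₁₁)

  shared-endpoint : {x y q : Vertex m} → Critical c 0F x y → Critical c 1F x q
                  → StarCover c ⊎ C5Cover c
  shared-endpoint {x} {y} {q} crit₀ crit₁ with first x Fin.≟ first y | first x Fin.≟ first q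
  ... | yes x≈y | _       = inj₁ (x , y , 1F , 1F , critical-twins⇒cover crit₀ x≈y)
  ... | no _    | yes x≈q = inj₁ (x , q , 0F , 0F , critical-twins⇒cover crit₁ x≈q)
  ... | no x~y  | no x~q  = SharedEndpoint.cover crit₀ crit₁ x~y x~q

lemma7 : (m : ℕ) → 1 ≤ m → (c : Coloring m)
    → (x y p q : Vertex m)
    → Critical c zero x y → Critical c (suc zero) p q
    → (x ≡ p ⊎ x ≡ q ⊎ y ≡ p ⊎ y ≡ q)
    → (∃ λ u → ∃ λ w → ∃ λ i → ∃ λ j → ∀ v → InStar c i u v ⊎ InStar c j w v)
    ⊎ (∃ λ i → ∃ λ j → Σ (C5Sub c i) λ H → Σ (C5Sub c j) λ H' → ∀ v → InSub H v ⊎ InSub H' v)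
lemma7 m _ c x y p q crit₀ crit₁ (inj₁ refl)                 = shared-endpoint c crit₀ crit₁
lemma7 m _ c x y p q crit₀ crit₁ (inj₂ (inj₁ refl))          = shared-endpoint c crit₀ (critical-sym c crit₁)
lemma7 m _ c x y p q crit₀ crit₁ (inj₂ (inj₂ (inj₁ refl)))   = shared-endpoint c (critical-sym c crit₀) crit₁
lemma7 m _ c x y p q crit₀ crit₁ (inj₂ (inj₂ (inj₂ refl)))   =
  shared-endpoint c (critical-sym c crit₀) (critical-sym c crit₁)
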